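{- Suppose $r,t\geq3$ are integers, $R\in\tilde M_r(t)$, and $x,y,z\in[t]$ are pairwise distinct with $f^R(x,y)=f^R(y,z)=f^R(x,z)=m(r)$. Then one of the following holds: (1) $r$ is even and $c^R(xy)=c^R(yz)=c^R(xz)=[m(r)-1,r]$; (2) $r$ is odd and for some relabeling $\{x,y,z\}=\{u,v,w\}$ one of the following holds: (a) $c^R(uv)=c^R(uw)=c^R(vw)=[m(r)-1,r-1]$; (b) $c^R(uv)=c^R(uw)=[m(r),r]$ and $c^R(vw)\subseteq[m(r)-1,r]$.
   Context: $[r]=\{1,\ldots,r\}$, $[i,j]=\{i,\ldots,j\}$, $m(r)=\lceil\frac{r+1}2\rceil$. An $r$-graph is a pair $R=(V,c^R)$ with $c^R:\binom V2\to2^{[r]}$. A violating triple is $(i,j,k)\in\mathbb N^3$ for which $|i-j|\leq k\leq i+j$ fails. $\tilde M_r(t)$ is the set of $r$-graphs $([t],c)$ with no pairwise distinct $x,y,z$ and violating triple $(i,j,k)$ such that $i\in c(xy)$, $j\in c(yz)$, $k\in c(xz)$. For $ij\in\binom{[t]}2$, $f^R(i,j)=\max\{|c^R(ij)|,1\}$. -}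

module Defs where

open import Data.Nat using (ℕ; zero; suc; _+_; _≤_; _≤ᵇ_; ⌊_/2⌋; ∣_-_∣; _⊔_)
open import Data.Nat.Divisibility using (_∣_)
open import Data.Bool using (_∧_)
open import Data.Fin using (Fin; toℕ)
open import Data.Fin.Subset using (Subset; _∈_; ∣_∣)
open import Data.Vec using (tabulate)
open import Data.Product using (_×_)
open import Data.Sum using (_⊎_)
open import Relation.Nullary using (¬_)
open import Relation.Binary.PropositionalEquality using (_≡_; _≢_)

-- Colours [r] = {1,…,r} are represented by Fin r; index i stands for colour suc (toℕ i).
colour : {r : ℕ} → Fin r → ℕ
colour i = suc (toℕ i)

-- An r-graph on vertex set [t] (represented by Fin t): a colouring of unordered
-- pairs by subsets of [r], modelled as a symmetric function (diagonal irrelevant).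
record RGraph (r t : ℕ) : Set where
  field
    c   : Fin t → Fin t → Subset r
    sym : ∀ x y → c x y ≡ c y x
open RGraph public

-- m(r) = ⌈(r+1)/2⌉ = ⌊(r+2)/2⌋
m : ℕ → ℕ
m r = ⌊ r + 2 /2⌋

Violating : ℕ → ℕ → ℕ → Set
Violating i j k = ¬ (∣ i - j ∣ ≤ k × k ≤ i + j)

InMtilde : {r t : ℕ} → RGraph r t → Set
InMtilde {r} {t} R =
  (x y z : Fin t) → x ≢ y → y ≢ z → x ≢ z →
  (i j k : Fin r) → i ∈ c R x y → j ∈ c R y z → k ∈ c R x z →
  ¬ Violating (colour i) (colour j) (colour k)

f : {r t : ℕ} → RGraph r t → Fin t → Fin t → ℕ
f R x y = ∣ c R x y ∣ ⊔ 1

interval : (r : ℕ) → ℕ → ℕ → Subset r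
interval r a b = tabulate (λ i → (a ≤ᵇ colour i) ∧ (colour i ≤ᵇ b))

Even : ℕ → Set
Even r = 2 ∣ r

Odd : ℕ → Set
Odd r = ¬ (2 ∣ r)

Relabel : {A : Set} → A → A → A → A → A → A → Set
Relabel x y z u v w =
    (u ≡ x × v ≡ y × w ≡ z)
  ⊎ (u ≡ x × v ≡ z × w ≡ y)
  ⊎ (u ≡ y × v ≡ x × w ≡ z)
  ⊎ (u ≡ y × v ≡ z × w ≡ x)
  ⊎ (u ≡ z × v ≡ x × w ≡ y)
  ⊎ (u ≡ z × v ≡ y × w ≡ x)

-- Let a, b, c be the least colours on the edges xy, yz, xz. The triangle inequality bounds every
-- colour of xy by b + c, so the m(r) colours of xy fit into [a, b + c] and [a, r]; that is,
-- a + m(r) - 1 ≤ b + c and a + m(r) - 1 ≤ r, and cyclically. For even r these force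
-- a = b = c = m(r) - 1, so each edge carries a full interval of m(r) colours ending at r.
-- For odd r the least colours are at most m(r), and either all equal m(r) - 1 (so each edge is
-- [m(r) - 1, r - 1]), or two of them equal m(r) (those edges are [m(r), r]) and the third is at
-- least m(r) - 1.
module Submission where

open import Defs hiding (sym)
open import Data.Nat using (ℕ; zero; suc; _+_; _*_; _∸_; ⌊_/2⌋; _≤_; _<_; z≤n; s≤s; z<s; s≤s⁻¹; _⊔_; ∣_-_∣)
open import Data.Nat.Properties
open import Data.Nat.Divisibility using (divides)
open import Data.Fin using (Fin; toℕ) renaming (zero to fzero; suc to fsuc)
open import Data.Fin.Properties using (toℕ<n)
open import Data.Fin.Subset using (Subset; _∈_; _⊆_; ∣_∣; inside; outside)
open import Data.Fin.Subset.Properties using (_∈?_; ⊆-antisym; p⊂q⇒∣p∣<∣q∣)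
open import Data.Vec using (_∷_; []; here; there)
open import Data.Vec.Properties using (lookup∘tabulate; []=⇒lookup; lookup⇒[]=)
open import Data.Bool.Properties using (T-≡; T-∧)
open import Data.Product using (_×_; _,_; proj₁; proj₂; ∃-syntax)
open import Data.Sum using (_⊎_; inj₁; inj₂)
open import Function.Bundles using (Equivalence)
open import Relation.Nullary using (¬_; yes; no; contradiction)
open import Relation.Nullary.Decidable using (decidable-stable; _×-dec_)
open import Relation.Binary.PropositionalEquality
  using (_≡_; _≢_; refl; sym; trans; cong; cong₂; subst; module ≡-Reasoning)

-- Indices in [l, h), i.e. colours in [l + 1, h].
InRange : ∀ {n} → ℕ → ℕ → Subset n → Set
InRange {n} l h S = ∀ {i : Fin n} → i ∈ S → l ≤ toℕ i × toℕ i < h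

InRange-tail : ∀ {n x l h} {S : Subset n} → InRange l h (x ∷ S) → InRange (l ∸ 1) (h ∸ 1) S
InRange-tail S⊆ i∈S = let l≤i , i<h = S⊆ (there i∈S) in ∸-monoˡ-≤ 1 l≤i , ∸-monoˡ-≤ 1 i<h

pred∸pred≤∸ : ∀ l h → (h ∸ 1) ∸ (l ∸ 1) ≤ h ∸ l
pred∸pred≤∸ zero    h = m∸n≤m h 1
pred∸pred≤∸ (suc l) h = ≤-reflexive (∸-+-assoc h 1 l)

∣∣≤-InRange : ∀ {n l h} {S : Subset n} → InRange l h S → ∣ S ∣ ≤ h ∸ l
∣∣≤-InRange {S = []} _ = z≤n
∣∣≤-InRange {l = l} {h} {outside ∷ S} S⊆ =
  ≤-trans (∣∣≤-InRange (InRange-tail S⊆)) (pred∸pred≤∸ l h)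
∣∣≤-InRange {S = inside ∷ S} S⊆ with S⊆ here
... | z≤n , s≤s z≤n = s≤s (∣∣≤-InRange (InRange-tail S⊆))

InRange-size : ∀ {n l h k} {S : Subset n} → InRange l h S → ∣ S ∣ ≡ suc k → suc l + k ≤ h
InRange-size {l = l} {h} {k} S⊆ ∣S∣ = begin
  suc l + k   ≡⟨ sym (+-suc l k) ⟩
  l + suc k   ≤⟨ +-monoʳ-≤ l 1+k≤h∸l ⟩
  l + (h ∸ l) ≡⟨ m+[n∸m]≡n (<⇒≤ (m∸n≢0⇒n<m {h} {l} λ h∸l≡0 → contradiction (subst (suc k ≤_) h∸l≡0 1+k≤h∸l) λ ())) ⟩
  h           ∎
  where
  open ≤-Reasoning
  1+k≤h∸l : suc k ≤ h ∸ l
  1+k≤h∸l = subst (_≤ h ∸ l) ∣S∣ (∣∣≤-InRange S⊆)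

⊆∧∣∣≥⇒≡ : ∀ {n} {S T : Subset n} → S ⊆ T → ∣ T ∣ ≤ ∣ S ∣ → S ≡ T
⊆∧∣∣≥⇒≡ {S = S} {T} S⊆T ∣T∣≤∣S∣ = ⊆-antisym S⊆T T⊆S
  where
  T⊆S : T ⊆ S
  T⊆S {x} x∈T with x ∈? S
  ... | yes x∈S = x∈S
  ... | no  x∉S = contradiction ∣T∣≤∣S∣ (<⇒≱ (p⊂q⇒∣p∣<∣q∣ (S⊆T , x , x∈T , x∉S)))

∈-interval⁺ : ∀ {r a b} {i : Fin r} → a ≤ colour i → colour i ≤ b → i ∈ interval r a b
∈-interval⁺ {r} {a} {b} {i} a≤i i≤b = lookup⇒[]= i (interval r a b)
  (trans (lookup∘tabulate _ i) (Equivalence.to T-≡ (Equivalence.from T-∧ (≤⇒≤ᵇ a≤i , ≤⇒≤ᵇ i≤b))))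

∈-interval⁻ : ∀ {r a b} {i : Fin r} → i ∈ interval r a b → a ≤ colour i × colour i ≤ b
∈-interval⁻ {r} {a} {b} {i} i∈I =
  let a≤ᵇi , i≤ᵇb = Equivalence.to T-∧ (Equivalence.from T-≡
                      (trans (sym (lookup∘tabulate _ i)) ([]=⇒lookup i∈I)))
  in ≤ᵇ⇒≤ a _ a≤ᵇi , ≤ᵇ⇒≤ _ b i≤ᵇb

InRange⇒⊆interval : ∀ {r l h} {S : Subset r} → InRange l h S → S ⊆ interval r (suc l) h
InRange⇒⊆interval S⊆ i∈S = let l≤i , i<h = S⊆ i∈S in ∈-interval⁺ (s≤s l≤i) i<h

interval-InRange : ∀ r l h → InRange l h (interval r (suc l) h)
interval-InRange r l h i∈I = let l<i , i≤h = ∈-interval⁻ i∈I in s≤s⁻¹ l<i , i≤h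

InRange-exact : ∀ {r l h lo k} {S : Subset r} →
  InRange l h S → ∣ S ∣ ≡ suc k → suc l ≡ lo → h ≡ lo + k → S ≡ interval r lo (lo + k)
InRange-exact {r} {l} {k = k} {S} S⊆ ∣S∣ refl refl =
  ⊆∧∣∣≥⇒≡ (InRange⇒⊆interval S⊆) (begin
    ∣ interval r (suc l) (suc l + k) ∣ ≤⟨ ∣∣≤-InRange (interval-InRange r l (suc l + k)) ⟩
    suc l + k ∸ l                     ≡⟨ cong (_∸ l) (sym (+-suc l k)) ⟩
    l + suc k ∸ l                     ≡⟨ m+n∸m≡n l (suc k) ⟩
    suc k                             ≡⟨ sym ∣S∣ ⟩
    ∣ S ∣                             ∎)
  where open ≤-Reasoning

lower-bound⇒⊆interval : ∀ {r l lo} {S : Subset r} →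
  (∀ {i} → i ∈ S → l ≤ toℕ i) → lo ≤ suc l → S ⊆ interval r lo r
lower-bound⇒⊆interval l≤ lo≤1+l {i} i∈S = ∈-interval⁺ (≤-trans lo≤1+l (s≤s (l≤ i∈S))) (toℕ<n i)

record Least {n} (S : Subset n) : Set where
  field
    min  : Fin n
    min∈ : min ∈ S
    min≤ : ∀ {j} → j ∈ S → toℕ min ≤ toℕ j

least : ∀ {n} (S : Subset n) → 0 < ∣ S ∣ → Least S
least (inside ∷ S) _ = record { min = fzero ; min∈ = here ; min≤ = λ _ → z≤n }
least (outside ∷ S) 0<∣S∣ = record
  { min  = fsuc min
  ; min∈ = there min∈
  ; min≤ = λ { (there j∈S) → s≤s (min≤ j∈S) }
  }
  where open Least (least S 0<∣S∣)

Triangle : ℕ → ℕ → ℕ → Set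
Triangle i j k = i ≤ j + k × j ≤ i + k × k ≤ i + j

¬Violating⇒Triangle : ∀ {i j k} → ¬ Violating i j k → Triangle i j k
¬Violating⇒Triangle {i} {j} {k} ¬violating =
  let ∣i-j∣≤k , k≤i+j = decidable-stable (∣ i - j ∣ ≤? k ×-dec k ≤? i + j) ¬violating
  in ≤-trans (m≤n+∣m-n∣ i j) (+-monoʳ-≤ j ∣i-j∣≤k) ,
     ≤-trans (m≤n+∣n-m∣ j i) (+-monoʳ-≤ i ∣i-j∣≤k) ,
     k≤i+j

record Balanced (s α β γ : ℕ) : Set where
  field
    α-bound : α + s ≤ β + γ
    β-bound : β + s ≤ α + γ
    γ-bound : γ + s ≤ α + β

rotate : ∀ {s α β γ} → Balanced s α β γ → Balanced s β γ α
rotate {s} {α} {β} {γ} b = record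
  { α-bound = subst (β + s ≤_) (+-comm α γ) β-bound
  ; β-bound = subst (γ + s ≤_) (+-comm α β) γ-bound
  ; γ-bound = α-bound
  }
  where open Balanced b

bounded-by : ∀ {s α β γ} → α + s ≤ β + γ → β ≤ s → γ ≤ s → α ≤ s
bounded-by {s} {α} α+s≤β+γ β≤s γ≤s = +-cancelʳ-≤ s α s (≤-trans α+s≤β+γ (+-mono-≤ β≤s γ≤s))

balanced-below⇒≡ : ∀ {s α β γ} → α ≤ s → β ≤ s → γ ≤ s → Balanced s α β γ → α ≡ s
balanced-below⇒≡ {s} {α} {β} {γ} α≤s β≤s γ≤s b = ≤-antisym α≤s s≤α
  where
  open Balanced b
  β≤α : β ≤ α
  β≤α = +-cancelʳ-≤ s β α (≤-trans β-bound (+-monoʳ-≤ α γ≤s))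
  γ≤α : γ ≤ α
  γ≤α = +-cancelʳ-≤ s γ α (≤-trans γ-bound (+-monoʳ-≤ α β≤s))
  s≤α : s ≤ α
  s≤α = +-cancelˡ-≤ α s α (≤-trans α-bound (+-mono-≤ β≤α γ≤α))

two-high⇒s≤third : ∀ {s α β γ} → α + s ≤ β + γ → α ≡ suc s → γ ≡ suc s → s ≤ β
two-high⇒s≤third {s} {β = β} α+s≤β+γ refl refl =
  +-cancelʳ-≤ (suc s) s β (subst (_≤ β + suc s) (+-comm (suc s) s) α+s≤β+γ)

≤-suc-cases : ∀ {α s} → α ≤ suc s → α ≤ s ⊎ α ≡ suc s
≤-suc-cases α≤1+s with m≤n⇒m<n∨m≡n α≤1+s
... | inj₁ α<1+s = inj₁ (s≤s⁻¹ α<1+s)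
... | inj₂ α≡1+s = inj₂ α≡1+s

data OddMinima (s α β γ : ℕ) : Set where
  all-mid : α ≡ s → β ≡ s → γ ≡ s → OddMinima s α β γ
  high-αβ : α ≡ suc s → β ≡ suc s → s ≤ γ → OddMinima s α β γ
  high-αγ : α ≡ suc s → γ ≡ suc s → s ≤ β → OddMinima s α β γ
  high-βγ : β ≡ suc s → γ ≡ suc s → s ≤ α → OddMinima s α β γ

odd-minima : ∀ {s α β γ} → α ≤ suc s → β ≤ suc s → γ ≤ suc s → Balanced s α β γ → OddMinima s α β γ
odd-minima {s} {α} {β} {γ} α≤ β≤ γ≤ b
  with ≤-suc-cases α≤ | ≤-suc-cases β≤ | ≤-suc-cases γ≤
... | inj₁ α≤s | inj₁ β≤s | inj₁ γ≤s = all-mid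
  (balanced-below⇒≡ α≤s β≤s γ≤s b)
  (balanced-below⇒≡ β≤s γ≤s α≤s (rotate b))
  (balanced-below⇒≡ γ≤s α≤s β≤s (rotate (rotate b)))
... | inj₁ α≤s | inj₁ β≤s | inj₂ refl =
  contradiction (bounded-by (Balanced.γ-bound b) α≤s β≤s) 1+n≰n
... | inj₁ α≤s | inj₂ refl | inj₁ γ≤s =
  contradiction (bounded-by (Balanced.β-bound b) α≤s γ≤s) 1+n≰n
... | inj₁ _ | inj₂ β≡ | inj₂ γ≡ = high-βγ β≡ γ≡ (two-high⇒s≤third (Balanced.β-bound b) β≡ γ≡)
... | inj₂ refl | inj₁ β≤s | inj₁ γ≤s =
  contradiction (bounded-by (Balanced.α-bound b) β≤s γ≤s) 1+n≰n
... | inj₂ α≡ | inj₁ _ | inj₂ γ≡ = high-αγ α≡ γ≡ (two-high⇒s≤third (Balanced.α-bound b) α≡ γ≡)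
... | inj₂ α≡ | inj₂ β≡ | inj₁ _ =
  high-αβ α≡ β≡ (two-high⇒s≤third (subst (α + s ≤_) (+-comm β γ) (Balanced.α-bound b)) α≡ β≡)
... | inj₂ α≡ | inj₂ β≡ | inj₂ refl = high-αβ α≡ β≡ (n≤1+n s)

data OddShape {r} (s : ℕ) (A B C : Subset r) : Set where
  flat    : A ≡ interval r s (s + s) → B ≡ interval r s (s + s) → C ≡ interval r s (s + s) →
            OddShape s A B C
  peak-AB : A ≡ interval r (suc s) (suc s + s) → B ≡ interval r (suc s) (suc s + s) →
            C ⊆ interval r s r → OddShape s A B C
  peak-AC : A ≡ interval r (suc s) (suc s + s) → C ≡ interval r (suc s) (suc s + s) →
            B ⊆ interval r s r → OddShape s A B C
  peak-BC : B ≡ interval r (suc s) (suc s + s) → C ≡ interval r (suc s) (suc s + s) →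
            A ⊆ interval r s r → OddShape s A B C

module ColourTriangle {r s : ℕ} {A B C : Subset r}
  (∣A∣ : ∣ A ∣ ≡ suc s) (∣B∣ : ∣ B ∣ ≡ suc s) (∣C∣ : ∣ C ∣ ≡ suc s)
  (triangle : ∀ {i j k} → i ∈ A → j ∈ B → k ∈ C → Triangle (colour i) (colour j) (colour k))
  where

  nonempty : ∀ {S : Subset r} → ∣ S ∣ ≡ suc s → 0 < ∣ S ∣
  nonempty ∣S∣ = subst (0 <_) (sym ∣S∣) z<s

  open Least (least A (nonempty {A} ∣A∣)) renaming (min to a₀; min∈ to a₀∈A; min≤ to a₀≤)
  open Least (least B (nonempty {B} ∣B∣)) renaming (min to b₀; min∈ to b₀∈B; min≤ to b₀≤)
  open Least (least C (nonempty {C} ∣C∣)) renaming (min to c₀; min∈ to c₀∈C; min≤ to c₀≤)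

  α β γ : ℕ
  α = colour a₀
  β = colour b₀
  γ = colour c₀

  A-InRange-r : InRange (toℕ a₀) r A
  A-InRange-r i∈A = a₀≤ i∈A , toℕ<n _
  B-InRange-r : InRange (toℕ b₀) r B
  B-InRange-r i∈B = b₀≤ i∈B , toℕ<n _
  C-InRange-r : InRange (toℕ c₀) r C
  C-InRange-r i∈C = c₀≤ i∈C , toℕ<n _

  A-InRange-βγ : InRange (toℕ a₀) (β + γ) A
  A-InRange-βγ i∈A = a₀≤ i∈A , proj₁ (triangle i∈A b₀∈B c₀∈C)
  B-InRange-αγ : InRange (toℕ b₀) (α + γ) B
  B-InRange-αγ j∈B = b₀≤ j∈B , proj₁ (proj₂ (triangle a₀∈A j∈B c₀∈C))
  C-InRange-αβ : InRange (toℕ c₀) (α + β) C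
  C-InRange-αβ k∈C = c₀≤ k∈C , proj₂ (proj₂ (triangle a₀∈A b₀∈B k∈C))

  balanced : Balanced s α β γ
  balanced = record
    { α-bound = InRange-size A-InRange-βγ ∣A∣
    ; β-bound = InRange-size B-InRange-αγ ∣B∣
    ; γ-bound = InRange-size C-InRange-αβ ∣C∣
    }

  least-bound : ∀ {h l} {S : Subset r} → InRange l r S → ∣ S ∣ ≡ suc s → r ≡ h + s → suc l ≤ h
  least-bound {h} S⊆ ∣S∣ refl = +-cancelʳ-≤ s _ h (InRange-size S⊆ ∣S∣)

  even-shape : r ≡ s + s →
    A ≡ interval r s (s + s) × B ≡ interval r s (s + s) × C ≡ interval r s (s + s)
  even-shape r≡ =
    InRange-exact A-InRange-r ∣A∣ α≡s r≡ ,
    InRange-exact B-InRange-r ∣B∣ β≡s r≡ ,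
    InRange-exact C-InRange-r ∣C∣ γ≡s r≡
    where
    α≤s = least-bound A-InRange-r ∣A∣ r≡
    β≤s = least-bound B-InRange-r ∣B∣ r≡
    γ≤s = least-bound C-InRange-r ∣C∣ r≡
    α≡s = balanced-below⇒≡ α≤s β≤s γ≤s balanced
    β≡s = balanced-below⇒≡ β≤s γ≤s α≤s (rotate balanced)
    γ≡s = balanced-below⇒≡ γ≤s α≤s β≤s (rotate (rotate balanced))

  odd-shape : r ≡ suc (s + s) → OddShape s A B C
  odd-shape r≡ with odd-minima (least-bound A-InRange-r ∣A∣ r≡)
                               (least-bound B-InRange-r ∣B∣ r≡)
                               (least-bound C-InRange-r ∣C∣ r≡) balanced
  ... | all-mid α≡ β≡ γ≡ = flat
    (InRange-exact A-InRange-βγ ∣A∣ α≡ (cong₂ _+_ β≡ γ≡))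
    (InRange-exact B-InRange-αγ ∣B∣ β≡ (cong₂ _+_ α≡ γ≡))
    (InRange-exact C-InRange-αβ ∣C∣ γ≡ (cong₂ _+_ α≡ β≡))
  ... | high-αβ α≡ β≡ s≤γ = peak-AB
    (InRange-exact A-InRange-r ∣A∣ α≡ r≡)
    (InRange-exact B-InRange-r ∣B∣ β≡ r≡)
    (lower-bound⇒⊆interval c₀≤ s≤γ)
  ... | high-αγ α≡ γ≡ s≤β = peak-AC
    (InRange-exact A-InRange-r ∣A∣ α≡ r≡)
    (InRange-exact C-InRange-r ∣C∣ γ≡ r≡)
    (lower-bound⇒⊆interval b₀≤ s≤β)
  ... | high-βγ β≡ γ≡ s≤α = peak-BC
    (InRange-exact B-InRange-r ∣B∣ β≡ r≡)
    (InRange-exact C-InRange-r ∣C∣ γ≡ r≡)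
    (lower-bound⇒⊆interval a₀≤ s≤α)

data Halving : ℕ → Set where
  even : ∀ s → Halving (s + s)
  odd  : ∀ s → Halving (suc (s + s))

halving : ∀ n → Halving n
halving zero = even 0
halving (suc n) with halving n
... | even s = odd s
... | odd s  = subst Halving (cong suc (+-suc s s)) (even (suc s))

s+s≡s*2 : ∀ s → s + s ≡ s * 2
s+s≡s*2 s = trans (cong (s +_) (sym (+-identityʳ s))) (*-comm 2 s)

even-sum : ∀ s → Even (s + s)
even-sum s = divides s (s+s≡s*2 s)

odd-sum : ∀ s → Odd (suc (s + s))
odd-sum s (divides q 1+s+s≡q*2) = even≢odd q s (begin
  2 * q           ≡⟨ *-comm 2 q ⟩
  q * 2           ≡⟨ sym 1+s+s≡q*2 ⟩
  suc (s + s)     ≡⟨ cong suc (s+s≡s*2 s) ⟩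
  suc (s * 2)     ≡⟨ cong suc (*-comm s 2) ⟩
  suc (2 * s)     ∎)
  where open ≡-Reasoning

m≡1+⌊n/2⌋ : ∀ n → m n ≡ suc ⌊ n /2⌋
m≡1+⌊n/2⌋ n = cong ⌊_/2⌋ (+-comm n 2)

m-even : ∀ s → m (s + s) ≡ suc s
m-even s = trans (m≡1+⌊n/2⌋ (s + s)) (cong suc (sym (n≡⌊n+n/2⌋ s)))

m-odd : ∀ s → m (suc (s + s)) ≡ suc s
m-odd s = trans (m≡1+⌊n/2⌋ (suc (s + s))) (cong suc (sym (n≡⌈n+n/2⌉ s)))

2≤s+s⇒0<s : ∀ {s} → 2 ≤ s + s → 0 < s
2≤s+s⇒0<s {zero} ()
2≤s+s⇒0<s {suc s} _ = z<s

⊔1≡1+⇒≡ : ∀ {n s} → 0 < s → n ⊔ 1 ≡ suc s → n ≡ suc s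
⊔1≡1+⇒≡ {zero} {zero} () refl
⊔1≡1+⇒≡ {suc n} _ n⊔0≡s = trans (cong suc (sym (⊔-identityʳ n))) n⊔0≡s

InMtilde⇒Triangle : ∀ {r t} (R : RGraph r t) → InMtilde R →
  ∀ {x y z} → x ≢ y → y ≢ z → x ≢ z →
  ∀ {i j k} → i ∈ c R x y → j ∈ c R y z → k ∈ c R x z → Triangle (colour i) (colour j) (colour k)
InMtilde⇒Triangle R mtilde x≢y y≢z x≢z i∈ j∈ k∈ =
  ¬Violating⇒Triangle (mtilde _ _ _ x≢y y≢z x≢z _ _ _ i∈ j∈ k∈)

relabel : ∀ {r t s} (R : RGraph r t) {x y z} → OddShape s (c R x y) (c R y z) (c R x z) →
  ∃[ u ] ∃[ v ] ∃[ w ] (Relabel x y z u v w ×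
    ((c R u v ≡ interval r s (s + s)
      × c R u w ≡ interval r s (s + s)
      × c R v w ≡ interval r s (s + s))
    ⊎ (c R u v ≡ interval r (suc s) (suc s + s)
      × c R u w ≡ interval r (suc s) (suc s + s)
      × c R v w ⊆ interval r s r)))
relabel R {x} {y} {z} (flat A≡ B≡ C≡) = x , y , z , inj₁ (refl , refl , refl) , inj₁ (A≡ , C≡ , B≡)
relabel R {x} {y} {z} (peak-AB A≡ B≡ C⊆) =
  y , x , z , inj₂ (inj₂ (inj₁ (refl , refl , refl))) , inj₂ (trans (RGraph.sym R y x) A≡ , B≡ , C⊆)
relabel R {x} {y} {z} (peak-AC A≡ C≡ B⊆) = x , y , z , inj₁ (refl , refl , refl) , inj₂ (A≡ , C≡ , B⊆)
relabel R {x} {y} {z} (peak-BC B≡ C≡ A⊆) =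
  z , x , y , inj₂ (inj₂ (inj₂ (inj₂ (inj₁ (refl , refl , refl))))) ,
  inj₂ (trans (RGraph.sym R z x) C≡ , trans (RGraph.sym R z y) B≡ , A⊆)

corollary4p15 : (r t : ℕ) → 3 ≤ r → 3 ≤ t → (R : RGraph r t) → InMtilde R →
    (x y z : Fin t) → x ≢ y → y ≢ z → x ≢ z →
    f R x y ≡ m r → f R y z ≡ m r → f R x z ≡ m r →
    (Even r × c R x y ≡ interval r (m r ∸ 1) r
            × c R y z ≡ interval r (m r ∸ 1) r
            × c R x z ≡ interval r (m r ∸ 1) r)
    ⊎ (Odd r × ∃[ u ] ∃[ v ] ∃[ w ] (Relabel x y z u v w ×
        ((c R u v ≡ interval r (m r ∸ 1) (r ∸ 1)
          × c R u w ≡ interval r (m r ∸ 1) (r ∸ 1)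
          × c R v w ≡ interval r (m r ∸ 1) (r ∸ 1))
        ⊎ (c R u v ≡ interval r (m r) r
          × c R u w ≡ interval r (m r) r
          × c R v w ⊆ interval r (m r ∸ 1) r))))
corollary4p15 r _ 3≤r _ R mtilde x y z x≢y y≢z x≢z fxy fyz fxz with halving r
... | even s rewrite m-even s =
  inj₁ (even-sum s , even-shape refl)
  where
  -- the rewrite has also turned fxy, fyz and fxz into equations with suc s
  size : ∀ {u v} → f R u v ≡ suc s → ∣ c R u v ∣ ≡ suc s
  size = ⊔1≡1+⇒≡ (2≤s+s⇒0<s (≤-trans (n≤1+n 2) 3≤r))
  open ColourTriangle (size fxy) (size fyz) (size fxz) (InMtilde⇒Triangle R mtilde x≢y y≢z x≢z)
... | odd s rewrite m-odd s =
  inj₂ (odd-sum s , relabel R (odd-shape refl))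
  where
  size : ∀ {u v} → f R u v ≡ suc s → ∣ c R u v ∣ ≡ suc s
  size = ⊔1≡1+⇒≡ (2≤s+s⇒0<s (s≤s⁻¹ 3≤r))
  open ColourTriangle (size fxy) (size fyz) (size fxz) (InMtilde⇒Triangle R mtilde x≢y y≢z x≢z)
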